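{- For every integer $k\geq 1$, as rational functions in $x,z$, $$F_k\left(x,\frac{x}{1-z}\right)=\frac{F_{k+1}(x,z)}{1-z}.$$
   Context: The polynomials $F_k(x,z)$ are defined by $F_0(x,z)=F_1(x,z)=1$, $F_2(x,z)=1-z$, and $F_k(x,z)=F_{k-1}(x,z)-xF_{k-2}(x,z)$ for $k\geq 3$. -}

module Defs where

open import Data.Nat using (ℕ; zero; suc)
open import Data.Rational using (ℚ; 1ℚ; _-_; _*_)

F : ℕ → ℚ → ℚ → ℚ
F zero x z = 1ℚ
F (suc zero) x z = 1ℚ
F (suc (suc zero)) x z = 1ℚ - z
F (suc (suc (suc k))) x z = F (suc (suc k)) x z - x * F (suc k) x z

-- With w = x / (1 - z), the sequence G k = F (k + 1) x z / (1 - z) satisfies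
-- G 1 = 1, G 2 = 1 - w and G (k + 3) = G (k + 2) - x G (k + 1), since dividing by
-- 1 - z commutes with the linear recurrence. These are exactly the equations
-- determining F k x w for k ≥ 1, so the two sequences agree.
module Submission where

open import Defs
open import Data.Nat using (ℕ; suc; _+_; _≤_)
open import Data.Rational using (ℚ; 1ℚ; _-_; _÷_; NonZero; _*_; 1/_)
open import Data.Rational.Properties using (*-inverseʳ; *-identityˡ)
open import Data.Rational.Solver using (module +-*-Solver)
open import Relation.Binary.PropositionalEquality
open ≡-Reasoning

F-unique : ∀ {x z} (G : ℕ → ℚ) → G 1 ≡ 1ℚ → G 2 ≡ 1ℚ - z →
           (∀ k → G (3 + k) ≡ G (2 + k) - x * G (1 + k)) →
           ∀ k → F (suc k) x z ≡ G (suc k)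
F-unique {x} {z} G G₁ G₂ G-step = go
  where
    go : ∀ k → F (suc k) x z ≡ G (suc k)
    go 0             = sym G₁
    go 1             = sym G₂
    go (suc (suc k)) = begin
      F (2 + k) x z - x * F (1 + k) x z  ≡⟨ cong₂ (λ p q → p - x * q) (go (suc k)) (go k) ⟩
      G (2 + k) - x * G (1 + k)          ≡⟨ sym (G-step k) ⟩
      G (3 + k)                          ∎

recurrence-*ʳ : ∀ a b x c → (a - x * b) * c ≡ a * c - x * (b * c)
recurrence-*ʳ = solve 4 (λ a b x c → (a :- x :* b) :* c := a :* c :- x :* (b :* c)) refl
  where open +-*-Solver

mainTheorem6 : (k : ℕ) → 1 ≤ k → (x z : ℚ) → .{{_ : NonZero (1ℚ - z)}} →
    F k x (x ÷ (1ℚ - z)) ≡ F (suc k) x z ÷ (1ℚ - z)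
mainTheorem6 (suc k) _ x z = F-unique G G₁ G₂ G-step k
  where
    d : ℚ
    d = 1ℚ - z

    G : ℕ → ℚ
    G n = F (suc n) x z ÷ d

    G₁ : G 1 ≡ 1ℚ
    G₁ = *-inverseʳ d

    G₂ : G 2 ≡ 1ℚ - x ÷ d
    G₂ = begin
      (d - x * 1ℚ) * 1/ d        ≡⟨ recurrence-*ʳ d 1ℚ x (1/ d) ⟩
      d * 1/ d - x * (1ℚ * 1/ d) ≡⟨ cong₂ (λ p q → p - x * q) (*-inverseʳ d) (*-identityˡ (1/ d)) ⟩
      1ℚ - x ÷ d                 ∎

    G-step : ∀ k → G (3 + k) ≡ G (2 + k) - x * G (1 + k)
    G-step k = recurrence-*ʳ (F (3 + k) x z) (F (2 + k) x z) x (1/ d)
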